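{- Let $p$ be an odd prime, $N\ge1$ an integer and $\mathcal V=\mathcal V(p,N)$. Then \[ A_{p,N}(\mathcal V,\mathcal V):=\frac1{\#\mathcal V^2}\sum_{\alpha\in\mathcal V}\sum_{\beta\in\mathcal V}\mathfrak d_{p,N}(\alpha,\beta)^2=\frac12\big(1-p^{ -1}-p^{ -2}\big). \]
   Context: $\omega=\exp(2\pi i/p)$; $\mathcal V(p,N)=\{\sum_{j=1}^{p-1}a_j\omega^j: a_j\in\{ -N,N\}\}$. For $\gamma\in\mathbb{Q}(\omega)$, $\mathrm{Tr}(\gamma)=\sum_{\sigma\in\mathrm{Gal}(\mathbb{Q}(\omega)/\mathbb{Q})}\sigma(\gamma)$, $\|\gamma\|=\big(\sum_{j=1}^{p-1}\mathrm{Tr}(\gamma\omega^j)^2\big)^{1/2}$, $\mathfrak d_{p,N}(\alpha,\beta)=\|\beta-\alpha\|/(2Np(p-1)^{1/2})$. -}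

module Defs where

open import Data.Nat as ℕ using (ℕ; zero; suc; NonZero; _∸_)
open import Data.Nat.DivMod using (_mod_)
open import Data.Fin as Fin using (Fin; toℕ)
open import Data.Fin.Properties using (_≟_)
open import Data.Bool using (Bool; true; false; if_then_else_)
open import Data.Integer as ℤ using (ℤ; +_)
open import Data.Rational as ℚ using (ℚ; _/_)
open import Relation.Nullary using (yes; no)

sumFinℤ : (n : ℕ) → (Fin n → ℤ) → ℤ
sumFinℤ zero    f = + 0
sumFinℤ (suc n) f = f Fin.zero ℤ.+ sumFinℤ n (λ i → f (Fin.suc i))

consB : {n : ℕ} → Bool → (Fin n → Bool) → Fin (suc n) → Bool
consB b s Fin.zero    = b
consB b s (Fin.suc i) = s i

sumSigns : (n : ℕ) → ((Fin n → Bool) → ℚ) → ℚ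
sumSigns zero    f = f (λ ())
sumSigns (suc n) f =
  sumSigns n (λ s → f (consB true s)) ℚ.+ sumSigns n (λ s → f (consB false s))

-- 1/d for positive d (with the harmless convention 1/0 = 0, never used).
invℕ : ℕ → ℚ
invℕ zero    = ℚ.0ℚ
invℕ (suc k) = (+ 1) / suc k

-- The ring ℤ[ω], ω = exp(2πi/p), presented as ℤ[C_p] / (1 + ω + … + ω^{p-1}):
-- an element is a coefficient vector (c_0,…,c_{p-1}) standing for Σ c_m ω^m.

module Cyclotomic (p : ℕ) .{{_ : NonZero p}} where

  Elt : Set
  Elt = Fin p → ℤ

  ωpow : ℕ → Elt
  ωpow j m with m ≟ (j mod p)
  ... | yes _ = + 1
  ... | no  _ = + 0

  _⊕_ : Elt → Elt → Elt
  (γ ⊕ δ) m = γ m ℤ.+ δ m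

  _⊖_ : Elt → Elt → Elt
  (γ ⊖ δ) m = γ m ℤ.- δ m

  scale : ℤ → Elt → Elt
  scale c γ m = c ℤ.* γ m

  sumElt : (n : ℕ) → (Fin n → Elt) → Elt
  sumElt n f m = sumFinℤ n (λ i → f i m)

  _⊗_ : Elt → Elt → Elt
  γ ⊗ δ = sumElt p (λ i → sumElt p (λ j →
            scale (γ i ℤ.* δ j) (ωpow (toℕ i ℕ.+ toℕ j))))

  σ : ℕ → Elt → Elt
  σ k γ = sumElt p (λ i → scale (γ i) (ωpow (k ℕ.* toℕ i)))

  TrElt : Elt → Elt
  TrElt γ = sumElt (p ∸ 1) (λ k → σ (suc (toℕ k)) γ)

  -- The integer represented by an element d_0 + d (ω + … + ω^{p-1})
  -- (i.e. one whose coefficients d_1 = … = d_{p-1} agree), namely d_0 - d_1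
  -- (using ω + … + ω^{p-1} = -1).  The trace is always of this form.
  toℤ : Elt → ℤ
  toℤ γ = γ (0 mod p) ℤ.- γ (1 mod p)

  Tr : Elt → ℤ
  Tr γ = toℤ (TrElt γ)

  normSq : Elt → ℤ
  normSq γ = sumFinℤ (p ∸ 1) (λ j → let t = Tr (γ ⊗ ωpow (suc (toℕ j))) in t ℤ.* t)

  -- The element Σ_{j=1}^{p-1} a_j ω^j of 𝒱(p,N), with a_j = N if s_j = true, -N otherwise.
  vElt : ℕ → (Fin (p ∸ 1) → Bool) → Elt
  vElt N s = sumElt (p ∸ 1) (λ j →
               scale (if s j then + N else ℤ.- (+ N)) (ωpow (suc (toℕ j))))

  dSq : ℕ → Elt → Elt → ℚ
  dSq N α β = (normSq (β ⊖ α) / 1) ℚ.* invℕ (4 ℕ.* N ℕ.* N ℕ.* p ℕ.* p ℕ.* (p ∸ 1))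

  A : ℕ → ℚ
  A N = invℕ (2 ℕ.^ (p ∸ 1) ℕ.* 2 ℕ.^ (p ∸ 1)) ℚ.*
        sumSigns (p ∸ 1) (λ s → sumSigns (p ∸ 1) (λ t → dSq N (vElt N s) (vElt N t)))

-- In the coefficient model ℤ[C_p] the trace is Tr γ = p γ₀ - Σ_m γ_m: for p prime the maps m ↦ k m
-- (1 ≤ k < p) fix 0 and each send exactly one residue to 1. Multiplication by ω^j shifts coefficients and
-- preserves Σ_m γ_m, so for γ with γ₀ = 0 and S = Σ_j γ_j,
--   ‖γ‖² = Σ_j (p γ_j - S)² = p² Σ_j γ_j² - (p + 1) S².
-- For γ = β - α with α, β ∈ 𝒱 the coefficients γ_j = b_j - a_j are independent over 𝒱², of mean 0 and
-- mean square 2N², so Σ_j γ_j² and S² both average to (p - 1)·2N². The mean of ‖β - α‖² is therefore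
-- (p² - p - 1)(p - 1)·2N², and dividing by 4N²p²(p - 1) gives ½(1 - 1/p - 1/p²).

module Submission where

open import Data.Bool using (Bool; true; false; if_then_else_)
open import Data.Empty using (⊥-elim)
open import Data.Fin as Fin using (Fin; zero; suc; toℕ; opposite)
open import Data.Nat as ℕ using (ℕ)
open import Data.Nat.Primality using (Prime)
open import Data.Product using (∃-syntax; _×_; _,_)
open import Function using (_∘_; flip)
open import Relation.Binary.PropositionalEquality using (_≡_; _≢_; refl; sym; trans; cong; cong₂; subst; module ≡-Reasoning)
import Algebra.Properties.Semiring.Sum as SemiringSum
import Data.Integer.Properties as ℤₚ

open import Defs

-- A single instantiation shared by all modules below, so that their sums are syntactically equal.
module ℤ-Sum = SemiringSum ℤₚ.+-*-semiring

module ResidueArithmetic where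
  open import Data.Nat
  open import Data.Nat.Properties using (*-assoc; *-comm; *-identityʳ; +-identityʳ; +-monoʳ-≤; m≤m+n; 0≢1+n; <⇒≢; <⇒≱)
  open import Data.Nat.Divisibility using (divides; m%n≡0⇒n∣m)
  open import Data.Nat.DivMod
  open import Data.Nat.Coprimality using (prime⇒coprime; coprime-Bézout)
  open import Data.Nat.GCD using (module Bézout)
  open import Data.Nat.Primality using (¬prime[1])
  open import Data.Nat.Solver using (module +-*-Solver)
  open +-*-Solver using (solve; _:=_; _:+_; _:*_; con)

  module _ {p : ℕ} .{{_ : NonZero p}} where

    %-*-congˡ : ∀ x y → ((x % p) * y) % p ≡ (x * y) % p
    %-*-congˡ x y = begin
      (x % p * y) % p           ≡⟨ %-distribˡ-* (x % p) y p ⟩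
      (x % p % p * (y % p)) % p ≡⟨ cong (λ r → (r * (y % p)) % p) (m%n%n≡m%n x p) ⟩
      (x % p * (y % p)) % p     ≡⟨ %-distribˡ-* x y p ⟨
      (x * y) % p               ∎
      where open ≡-Reasoning

    %-*-congʳ : ∀ x y → (x * (y % p)) % p ≡ (x * y) % p
    %-*-congʳ x y = begin
      (x * (y % p)) % p ≡⟨ cong (_% p) (*-comm x (y % p)) ⟩
      (y % p * x) % p   ≡⟨ %-*-congˡ y x ⟩
      (y * x) % p       ≡⟨ cong (_% p) (*-comm y x) ⟩
      (x * y) % p       ∎
      where open ≡-Reasoning

    %-*-cancel : ∀ {b y} → (b * y) % p ≡ 1 → ∀ a → ((a * b) % p * y) % p ≡ a % p
    %-*-cancel {b} {y} by≡1 a = begin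
      ((a * b) % p * y) % p ≡⟨ %-*-congˡ (a * b) y ⟩
      (a * b * y) % p       ≡⟨ cong (_% p) (*-assoc a b y) ⟩
      (a * (b * y)) % p     ≡⟨ %-*-congʳ a (b * y) ⟨
      (a * ((b * y) % p)) % p ≡⟨ cong (λ r → (a * r) % p) by≡1 ⟩
      (a * 1) % p           ≡⟨ cong (_% p) (*-identityʳ a) ⟩
      a % p                 ∎
      where open ≡-Reasoning

  m%n≡0⇒m≡n : ∀ {m n} .{{_ : NonZero n}} → 0 < m → m < n + n → m % n ≡ 0 → m ≡ n
  m%n≡0⇒m≡n {m} {n} 0<m m<2n m%n≡0 with m%n≡0⇒n∣m m n m%n≡0
  ... | divides 0        m≡0  = ⊥-elim (<⇒≢ 0<m (sym m≡0))
  ... | divides 1        m≡n  = trans m≡n (+-identityʳ n)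
  ... | divides (2+ q) m≡qn = ⊥-elim (<⇒≱ m<2n (subst (n + n ≤_) (sym m≡qn) (+-monoʳ-≤ n (m≤m+n n (q * n)))))

  %-inverseʳ : ∀ {p b} .{{_ : NonZero p}} → Prime p → 0 < b → b < p → ∃[ y ] (b * y) % p ≡ 1
  %-inverseʳ {1}        p-prime _ _ = ⊥-elim (¬prime[1] p-prime)
  %-inverseʳ {2+ k} {b} p-prime 0<b b<p with coprime-Bézout (prime⇒coprime p-prime {{>-nonZero 0<b}} b<p)
  ... | Bézout.-+ x y 1+xp≡yb = y , (begin
    (b * y) % (2+ k)          ≡⟨ cong (_% 2+ k) (trans (*-comm b y) (sym 1+xp≡yb)) ⟩
    (1 + x * 2+ k) % 2+ k     ≡⟨ [m+kn]%n≡m%n 1 x (2+ k) ⟩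
    1                         ∎)
    where open ≡-Reasoning
  ... | Bézout.+- x y 1+yb≡xp = y * suc k , (begin
    (b * (y * suc k)) % 2+ k       ≡⟨ cong (_% 2+ k) (sym (*-assoc b y (suc k))) ⟩
    (b * y * suc k) % 2+ k         ≡⟨ %-*-congˡ (b * y) (suc k) ⟨
    ((b * y) % 2+ k * suc k) % 2+ k ≡⟨ cong (λ r → (r * suc k) % 2+ k) by≡-1 ⟩
    (suc k * suc k) % 2+ k         ≡⟨ cong (_% 2+ k) (solve 1 (λ k → (con 1 :+ k) :* (con 1 :+ k) := con 1 :+ k :* (con 2 :+ k)) refl k) ⟩
    (1 + k * 2+ k) % 2+ k          ≡⟨ [m+kn]%n≡m%n 1 k (2+ k) ⟩
    1                              ∎)
    where
    open ≡-Reasoning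
    -- b y ≡ -1, hence b y (p - 1) ≡ (p - 1)² ≡ 1 (mod p)
    by≡-1 : (b * y) % 2+ k ≡ suc k
    by≡-1 = %-pred-≡0 {b * y} (trans (cong (λ r → suc r % 2+ k) (*-comm b y))
                        (trans (cong (_% 2+ k) 1+yb≡xp) (m*n%n≡0 x (2+ k))))

  module _ {p : ℕ} .{{_ : NonZero p}} (p-prime : Prime p) {b : ℕ} (0<b : 0 < b) (b<p : b < p) where

    *-%-injectiveˡ : ∀ {a₁ a₂} → (a₁ * b) % p ≡ (a₂ * b) % p → a₁ % p ≡ a₂ % p
    *-%-injectiveˡ {a₁} {a₂} eq with y , by≡1 ← %-inverseʳ p-prime 0<b b<p =
      trans (sym (%-*-cancel by≡1 a₁)) (trans (cong (λ r → (r * y) % p) eq) (%-*-cancel by≡1 a₂))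

    *-%-cancelʳ : ∀ {a₁ a₂} → a₁ < p → a₂ < p → (a₁ * b) % p ≡ (a₂ * b) % p → a₁ ≡ a₂
    *-%-cancelʳ a₁<p a₂<p eq = trans (sym (m<n⇒m%n≡m a₁<p)) (trans (*-%-injectiveˡ eq) (m<n⇒m%n≡m a₂<p))

    *-%-≢0 : ∀ {a} → 0 < a → a < p → (a * b) % p ≢ 0
    *-%-≢0 {a} 0<a a<p ab≡0 = <⇒≢ 0<a (sym (*-%-cancelʳ a<p (>-nonZero⁻¹ p) (trans ab≡0 (sym (m*n%n≡0 0 p)))))

    %-inverseˡ : ∃[ a ] 0 < a × a < p × (a * b) % p ≡ 1
    %-inverseˡ with y , by≡1 ← %-inverseʳ p-prime 0<b b<p = y % p , 0<a , m%n<n y p , ab≡1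
      where
      ab≡1 : (y % p * b) % p ≡ 1
      ab≡1 = trans (%-*-congˡ y b) (trans (cong (_% p) (*-comm y b)) by≡1)
      0<a : 0 < y % p
      0<a with y % p in a≡
      ... | zero  = ⊥-elim (0≢1+n (trans (sym (m*n%n≡0 0 p)) (trans (cong (λ r → (r * b) % p) (sym a≡)) ab≡1)))
      ... | suc _ = z<s

module FiniteSums where
  open import Data.Fin.Permutation using (reverse)
  open import Data.Fin.Properties using (punchInᵢ≢i)
  open import Data.Integer using (ℤ; +_; -_; _+_; _-_; _*_; 0ℤ)
  open import Data.Integer.Solver using (module +-*-Solver)
  open +-*-Solver using (solve; _:=_; _:+_; _:-_; _:*_; con)
  open ℤ-Sum using (sum-syntax; sum-cong-≗; ∑-distrib-+; ∑-permute; sum-remove; sum-replicate-zero; *-distribˡ-sum)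

  sumFinℤ≡∑ : ∀ n (f : Fin n → ℤ) → sumFinℤ n f ≡ ∑[ i < n ] f i
  sumFinℤ≡∑ ℕ.zero    f = refl
  sumFinℤ≡∑ (ℕ.suc n) f = cong (_+_ (f zero)) (sumFinℤ≡∑ n (f ∘ suc))

  ∑-neg : ∀ {n} (f : Fin n → ℤ) → ∑[ i < n ] (- f i) ≡ - ∑[ i < n ] f i
  ∑-neg {ℕ.zero}  f = refl
  ∑-neg {ℕ.suc n} f = trans (cong (_+_ (- f zero)) (∑-neg (f ∘ suc))) (sym (ℤₚ.neg-distrib-+ (f zero) _))

  ∑-distrib-- : ∀ {n} (f g : Fin n → ℤ) → ∑[ i < n ] (f i - g i) ≡ ∑[ i < n ] f i - ∑[ i < n ] g i
  ∑-distrib-- f g = trans (∑-distrib-+ f (-_ ∘ g)) (cong (_+_ (∑[ i < _ ] f i)) (∑-neg g))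

  ∑-const : ∀ n c → ∑[ i < n ] c ≡ + n * c
  ∑-const ℕ.zero    c = refl
  ∑-const (ℕ.suc n) c = trans (cong (_+_ c) (∑-const n c)) (sym (ℤₚ.suc-* (+ n) c))

  ∑-reverse : ∀ {n} (f : Fin n → ℤ) → ∑[ i < n ] f (opposite i) ≡ ∑[ i < n ] f i
  ∑-reverse f = sym (∑-permute f reverse)

  ∑-vanish : ∀ {n} (f : Fin n → ℤ) → (∀ i → f i ≡ 0ℤ) → ∑[ i < n ] f i ≡ 0ℤ
  ∑-vanish {n} f vanish = trans (sum-cong-≗ vanish) (sum-replicate-zero n)

  ∑-pick : ∀ {n} (f : Fin n → ℤ) i → (∀ j → j ≢ i → f j ≡ 0ℤ) → ∑[ j < n ] f j ≡ f i
  ∑-pick {ℕ.suc n} f i vanish = begin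
    ∑[ j < ℕ.suc n ] f j                 ≡⟨ sum-remove f ⟩
    f i + ∑[ j < n ] f (Fin.punchIn i j) ≡⟨ cong (_+_ (f i)) (∑-vanish (f ∘ Fin.punchIn i) (λ j → vanish _ (punchInᵢ≢i i j))) ⟩
    f i + 0ℤ                             ≡⟨ ℤₚ.+-identityʳ (f i) ⟩
    f i                                  ∎
    where open ≡-Reasoning

  ∑-scaled-deviation² : ∀ {m} c (x : Fin m → ℤ) →
    ∑[ j < m ] ((c * x j - ∑[ i < m ] x i) * (c * x j - ∑[ i < m ] x i))
      ≡ c * c * ∑[ j < m ] (x j * x j) - (+ 2 * c - + m) * ((∑[ i < m ] x i) * (∑[ i < m ] x i))
  ∑-scaled-deviation² {m} c x = begin
    ∑[ j < m ] ((c * x j - S) * (c * x j - S))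
      ≡⟨ sum-cong-≗ expand ⟩
    ∑[ j < m ] ((c * c * (x j * x j) - + 2 * c * S * x j) + S * S)
      ≡⟨ ∑-distrib-+ (λ j → c * c * (x j * x j) - + 2 * c * S * x j) (λ _ → S * S) ⟩
    ∑[ j < m ] (c * c * (x j * x j) - + 2 * c * S * x j) + ∑[ j < m ] (S * S)
      ≡⟨ cong₂ _+_ (∑-distrib-- (λ j → c * c * (x j * x j)) (λ j → + 2 * c * S * x j)) (∑-const m (S * S)) ⟩
    (∑[ j < m ] (c * c * (x j * x j)) - ∑[ j < m ] (+ 2 * c * S * x j)) + + m * (S * S)
      ≡⟨ cong₂ (λ a b → (a - b) + + m * (S * S))
               (sym (*-distribˡ-sum (c * c) (λ j → x j * x j))) (sym (*-distribˡ-sum (+ 2 * c * S) x)) ⟩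
    (c * c * ∑[ j < m ] (x j * x j) - + 2 * c * S * S) + + m * (S * S)
      ≡⟨ solve 4 (λ c Q S m → (c :* c :* Q :- con (+ 2) :* c :* S :* S) :+ m :* (S :* S)
                             := c :* c :* Q :- (con (+ 2) :* c :- m) :* (S :* S))
               refl c (∑[ j < m ] (x j * x j)) S (+ m) ⟩
    c * c * ∑[ j < m ] (x j * x j) - (+ 2 * c - + m) * (S * S) ∎
    where
    open ≡-Reasoning
    S = ∑[ i < m ] x i
    expand : ∀ j → (c * x j - S) * (c * x j - S) ≡ (c * c * (x j * x j) - + 2 * c * S * x j) + S * S
    expand j = solve 3 (λ c x S → (c :* x :- S) :* (c :* x :- S) := (c :* c :* (x :* x) :- con (+ 2) :* c :* S :* x) :+ S :* S)
                       refl c (x j) S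

module SignSums where
  import Data.Nat.Properties as ℕₚ
  open import Data.Integer using (ℤ; +_; -_; _+_; _-_; _*_; -1ℤ)
  open import Data.Integer.Solver using (module +-*-Solver)
  open +-*-Solver using (solve; _:=_; _:+_; _:*_; con)
  open import Data.Nat.Solver using () renaming (module +-*-Solver to ℕ-Solver)
  open ℕ-Solver using () renaming (solve to ℕsolve; _:=_ to _ℕ:=_; _:*_ to _ℕ:*_; con to ℕcon)
  open ℤ-Sum using (sum-syntax)

  signed : ℕ → Bool → ℤ
  signed N b = if b then + N else - + N

  Δ : ∀ {m} → ℕ → (Fin m → Bool) → (Fin m → Bool) → Fin m → ℤ
  Δ N s t j = signed N (t j) - signed N (s j)

  ∑Δ ∑Δ² : ∀ {m} → ℕ → (Fin m → Bool) → (Fin m → Bool) → ℤ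
  ∑Δ  {m} N s t = ∑[ j < m ] Δ N s t j
  ∑Δ² {m} N s t = ∑[ j < m ] (Δ N s t j * Δ N s t j)

  sumSignsℤ : (m : ℕ) → ((Fin m → Bool) → ℤ) → ℤ
  sumSignsℤ ℕ.zero    f = f (λ ())
  sumSignsℤ (ℕ.suc m) f = sumSignsℤ m (λ s → f (consB true s)) + sumSignsℤ m (λ s → f (consB false s))

  sumSignsℤ-cong : ∀ m {f g : (Fin m → Bool) → ℤ} → (∀ s → f s ≡ g s) → sumSignsℤ m f ≡ sumSignsℤ m g
  sumSignsℤ-cong ℕ.zero    f≗g = f≗g _
  sumSignsℤ-cong (ℕ.suc m) f≗g = cong₂ _+_ (sumSignsℤ-cong m (f≗g ∘ consB true)) (sumSignsℤ-cong m (f≗g ∘ consB false))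

  sumSignsℤ-distrib-+ : ∀ m (f g : (Fin m → Bool) → ℤ) → sumSignsℤ m (λ s → f s + g s) ≡ sumSignsℤ m f + sumSignsℤ m g
  sumSignsℤ-distrib-+ ℕ.zero    f g = refl
  sumSignsℤ-distrib-+ (ℕ.suc m) f g = trans
    (cong₂ _+_ (sumSignsℤ-distrib-+ m (f ∘ consB true) (g ∘ consB true)) (sumSignsℤ-distrib-+ m (f ∘ consB false) (g ∘ consB false)))
    (solve 4 (λ a b c d → (a :+ b) :+ (c :+ d) := (a :+ c) :+ (b :+ d)) refl
       (sumSignsℤ m (f ∘ consB true)) (sumSignsℤ m (g ∘ consB true)) (sumSignsℤ m (f ∘ consB false)) (sumSignsℤ m (g ∘ consB false)))

  sumSignsℤ-*ˡ : ∀ m c (f : (Fin m → Bool) → ℤ) → sumSignsℤ m (λ s → c * f s) ≡ c * sumSignsℤ m f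
  sumSignsℤ-*ˡ ℕ.zero    c f = refl
  sumSignsℤ-*ˡ (ℕ.suc m) c f = trans (cong₂ _+_ (sumSignsℤ-*ˡ m c (f ∘ consB true)) (sumSignsℤ-*ˡ m c (f ∘ consB false)))
                                     (sym (ℤₚ.*-distribˡ-+ c _ _))

  sumSignsℤ-const : ∀ m c → sumSignsℤ m (λ _ → c) ≡ + (2 ℕ.^ m) * c
  sumSignsℤ-const ℕ.zero    c = sym (ℤₚ.*-identityˡ c)
  sumSignsℤ-const (ℕ.suc m) c = begin
    sumSignsℤ m (λ _ → c) + sumSignsℤ m (λ _ → c) ≡⟨ cong₂ _+_ (sumSignsℤ-const m c) (sumSignsℤ-const m c) ⟩
    + (2 ℕ.^ m) * c + + (2 ℕ.^ m) * c             ≡⟨ solve 2 (λ w c → w :* c :+ w :* c := (con (+ 2) :* w) :* c) refl (+ (2 ℕ.^ m)) c ⟩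
    + 2 * + (2 ℕ.^ m) * c                         ≡⟨ cong (_* c) (sym (ℤₚ.pos-* 2 (2 ℕ.^ m))) ⟩
    + (2 ℕ.^ ℕ.suc m) * c                         ∎
    where open ≡-Reasoning

  sumSignPairs : (m : ℕ) → ((Fin m → Bool) → (Fin m → Bool) → ℤ) → ℤ
  sumSignPairs m F = sumSignsℤ m (λ s → sumSignsℤ m (F s))

  #signPairs : ℕ → ℕ
  #signPairs m = 2 ℕ.^ m ℕ.* 2 ℕ.^ m

  ∑Bool² : (Bool → Bool → ℤ) → ℤ
  ∑Bool² G = (G true true + G true false) + (G false true + G false false)

  module _ (m : ℕ) where

    sumSignPairs-cong : ∀ {F G} → (∀ s t → F s t ≡ G s t) → sumSignPairs m F ≡ sumSignPairs m G
    sumSignPairs-cong F≗G = sumSignsℤ-cong m (λ s → sumSignsℤ-cong m (F≗G s))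

    sumSignPairs-distrib-+ : ∀ F G → sumSignPairs m (λ s t → F s t + G s t) ≡ sumSignPairs m F + sumSignPairs m G
    sumSignPairs-distrib-+ F G = trans (sumSignsℤ-cong m (λ s → sumSignsℤ-distrib-+ m (F s) (G s))) (sumSignsℤ-distrib-+ m _ _)

    sumSignPairs-distrib-- : ∀ F G → sumSignPairs m (λ s t → F s t - G s t) ≡ sumSignPairs m F - sumSignPairs m G
    sumSignPairs-distrib-- F G = begin
      sumSignPairs m (λ s t → F s t - G s t)        ≡⟨ sumSignPairs-cong (λ s t → cong (_+_ (F s t)) (sym (ℤₚ.-1*i≡-i (G s t)))) ⟩
      sumSignPairs m (λ s t → F s t + -1ℤ * G s t)  ≡⟨ sumSignPairs-distrib-+ F (λ s t → -1ℤ * G s t) ⟩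
      sumSignPairs m F + sumSignPairs m (λ s t → -1ℤ * G s t)
        ≡⟨ cong (_+_ (sumSignPairs m F)) (trans (sumSignsℤ-cong m (λ s → sumSignsℤ-*ˡ m -1ℤ (G s))) (sumSignsℤ-*ˡ m -1ℤ _)) ⟩
      sumSignPairs m F + -1ℤ * sumSignPairs m G     ≡⟨ cong (_+_ (sumSignPairs m F)) (ℤₚ.-1*i≡-i _) ⟩
      sumSignPairs m F - sumSignPairs m G           ∎
      where open ≡-Reasoning

    sumSignPairs-*ˡ : ∀ c F → sumSignPairs m (λ s t → c * F s t) ≡ c * sumSignPairs m F
    sumSignPairs-*ˡ c F = trans (sumSignsℤ-cong m (λ s → sumSignsℤ-*ˡ m c (F s))) (sumSignsℤ-*ˡ m c _)

    sumSignPairs-const : ∀ c → sumSignPairs m (λ _ _ → c) ≡ + #signPairs m * c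
    sumSignPairs-const c = begin
      sumSignPairs m (λ _ _ → c)              ≡⟨ sumSignsℤ-cong m (λ _ → sumSignsℤ-const m c) ⟩
      sumSignsℤ m (λ _ → + (2 ℕ.^ m) * c)     ≡⟨ sumSignsℤ-const m _ ⟩
      + (2 ℕ.^ m) * (+ (2 ℕ.^ m) * c)         ≡⟨ sym (ℤₚ.*-assoc (+ (2 ℕ.^ m)) (+ (2 ℕ.^ m)) c) ⟩
      + (2 ℕ.^ m) * + (2 ℕ.^ m) * c           ≡⟨ cong (_* c) (sym (ℤₚ.pos-* (2 ℕ.^ m) (2 ℕ.^ m))) ⟩
      + #signPairs m * c                      ∎
      where open ≡-Reasoning

    sumSignPairs-shift : ∀ c F → sumSignPairs m (λ s t → c + F s t) ≡ + #signPairs m * c + sumSignPairs m F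
    sumSignPairs-shift c F = trans (sumSignPairs-distrib-+ (λ _ _ → c) F) (cong (_+ sumSignPairs m F) (sumSignPairs-const c))

    sumSignPairs-suc : ∀ F → sumSignPairs (ℕ.suc m) F ≡ ∑Bool² (λ b c → sumSignPairs m (λ s t → F (consB b s) (consB c t)))
    sumSignPairs-suc F = cong₂ _+_ (sumSignsℤ-distrib-+ m _ _) (sumSignsℤ-distrib-+ m _ _)

  #signPairs≢0 : ∀ m → ℕ.NonZero (#signPairs m)
  #signPairs≢0 m = ℕₚ.m*n≢0 (2 ℕ.^ m) (2 ℕ.^ m) {{ℕₚ.m^n≢0 2 m}} {{ℕₚ.m^n≢0 2 m}}

  #signPairs-suc : ∀ m → + #signPairs (ℕ.suc m) ≡ + 4 * + #signPairs m
  #signPairs-suc m =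
    trans (cong +_ (ℕsolve 1 (λ x → (ℕcon 2 ℕ:* x) ℕ:* (ℕcon 2 ℕ:* x) ℕ:= ℕcon 4 ℕ:* (x ℕ:* x)) refl (2 ℕ.^ m)))
          (ℤₚ.pos-* 4 (#signPairs m))

  ∑Bool²-cong : ∀ {G H} → (∀ b c → G b c ≡ H b c) → ∑Bool² G ≡ ∑Bool² H
  ∑Bool²-cong G≗H = cong₂ _+_ (cong₂ _+_ (G≗H true true) (G≗H true false)) (cong₂ _+_ (G≗H false true) (G≗H false false))

  ∑Bool²-affine : ∀ a x G → ∑Bool² (λ b c → a * G b c + x) ≡ a * ∑Bool² G + + 4 * x
  ∑Bool²-affine a x G = solve 6 (λ a x g₁ g₂ g₃ g₄ →
      ((a :* g₁ :+ x) :+ (a :* g₂ :+ x)) :+ ((a :* g₃ :+ x) :+ (a :* g₄ :+ x)) := a :* ((g₁ :+ g₂) :+ (g₃ :+ g₄)) :+ con (+ 4) :* x)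
    refl a x (G true true) (G true false) (G false true) (G false false)

module SignMoments (N : ℕ) where
  open SignSums
  open import Data.Integer using (ℤ; +_; -_; _+_; _-_; _*_; 0ℤ; 1ℤ)
  open import Data.Integer.Solver using (module +-*-Solver)
  open +-*-Solver using (solve; _:=_; _:+_; _:-_; _:*_; :-_; con)

  private
    δ : Bool → Bool → ℤ
    δ b c = signed N c - signed N b

  ∑Bool²-δ : ∑Bool² δ ≡ 0ℤ
  ∑Bool²-δ = solve 1 (λ N → (N :- N :+ (:- N :- N)) :+ (N :- :- N :+ (:- N :- :- N)) := con 0ℤ) refl (+ N)

  ∑Bool²-δ² : ∑Bool² (λ b c → δ b c * δ b c) ≡ + 4 * (+ 2 * (+ N * + N))
  ∑Bool²-δ² = solve 1 (λ N → ((N :- N) :* (N :- N) :+ (:- N :- N) :* (:- N :- N))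
                             :+ ((N :- :- N) :* (N :- :- N) :+ (:- N :- :- N) :* (:- N :- :- N))
                           := con (+ 4) :* (con (+ 2) :* (N :* N))) refl (+ N)

  sumSignPairs-∑Δ : ∀ m → sumSignPairs m (∑Δ N) ≡ 0ℤ
  sumSignPairs-∑Δ ℕ.zero    = refl
  sumSignPairs-∑Δ (ℕ.suc m) = begin
    sumSignPairs (ℕ.suc m) (∑Δ N)
      ≡⟨ sumSignPairs-suc m (∑Δ N) ⟩
    ∑Bool² (λ b c → sumSignPairs m (λ s t → δ b c + ∑Δ N s t))
      ≡⟨ ∑Bool²-cong block ⟩
    ∑Bool² (λ b c → + #signPairs m * δ b c + 0ℤ)
      ≡⟨ ∑Bool²-affine (+ #signPairs m) 0ℤ δ ⟩
    + #signPairs m * ∑Bool² δ + + 4 * 0ℤ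
      ≡⟨ cong (λ x → + #signPairs m * x + + 4 * 0ℤ) ∑Bool²-δ ⟩
    + #signPairs m * 0ℤ + + 4 * 0ℤ
      ≡⟨ cong (_+ + 4 * 0ℤ) (ℤₚ.*-zeroʳ (+ #signPairs m)) ⟩
    0ℤ ∎
    where
    open ≡-Reasoning
    block : ∀ b c → sumSignPairs m (λ s t → δ b c + ∑Δ N s t) ≡ + #signPairs m * δ b c + 0ℤ
    block b c = trans (sumSignPairs-shift m (δ b c) (∑Δ N)) (cong (_+_ (+ #signPairs m * δ b c)) (sumSignPairs-∑Δ m))

  sumSignPairs-∑Δ² : ∀ m → sumSignPairs m (∑Δ² N) ≡ + m * (+ #signPairs m * (+ 2 * (+ N * + N)))
  sumSignPairs-∑Δ² ℕ.zero    = refl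
  sumSignPairs-∑Δ² (ℕ.suc m) = begin
    sumSignPairs (ℕ.suc m) (∑Δ² N)
      ≡⟨ sumSignPairs-suc m (∑Δ² N) ⟩
    ∑Bool² (λ b c → sumSignPairs m (λ s t → δ b c * δ b c + ∑Δ² N s t))
      ≡⟨ ∑Bool²-cong block ⟩
    ∑Bool² (λ b c → + #signPairs m * (δ b c * δ b c) + X)
      ≡⟨ ∑Bool²-affine (+ #signPairs m) X (λ b c → δ b c * δ b c) ⟩
    + #signPairs m * ∑Bool² (λ b c → δ b c * δ b c) + + 4 * X
      ≡⟨ cong (λ x → + #signPairs m * x + + 4 * X) ∑Bool²-δ² ⟩
    + #signPairs m * (+ 4 * (+ 2 * (+ N * + N))) + + 4 * X
      ≡⟨ solve 3 (λ P m v → P :* (con (+ 4) :* v) :+ con (+ 4) :* (m :* (P :* v)) := (con 1ℤ :+ m) :* ((con (+ 4) :* P) :* v))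
               refl (+ #signPairs m) (+ m) (+ 2 * (+ N * + N)) ⟩
    + ℕ.suc m * (+ 4 * + #signPairs m * (+ 2 * (+ N * + N)))
      ≡⟨ cong (λ P → + ℕ.suc m * (P * (+ 2 * (+ N * + N)))) (sym (#signPairs-suc m)) ⟩
    + ℕ.suc m * (+ #signPairs (ℕ.suc m) * (+ 2 * (+ N * + N))) ∎
    where
    open ≡-Reasoning
    X = + m * (+ #signPairs m * (+ 2 * (+ N * + N)))
    block : ∀ b c → sumSignPairs m (λ s t → δ b c * δ b c + ∑Δ² N s t) ≡ + #signPairs m * (δ b c * δ b c) + X
    block b c = trans (sumSignPairs-shift m (δ b c * δ b c) (∑Δ² N))
                      (cong (_+_ (+ #signPairs m * (δ b c * δ b c))) (sumSignPairs-∑Δ² m))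

  sumSignPairs-[c+∑Δ]² : ∀ m c → sumSignPairs m (λ s t → (c + ∑Δ N s t) * (c + ∑Δ N s t))
                                 ≡ + #signPairs m * (c * c) + sumSignPairs m (λ s t → ∑Δ N s t * ∑Δ N s t)
  sumSignPairs-[c+∑Δ]² m c = begin
    sumSignPairs m (λ s t → (c + ∑Δ N s t) * (c + ∑Δ N s t))
      ≡⟨ sumSignPairs-cong m (λ s t → square (∑Δ N s t)) ⟩
    sumSignPairs m (λ s t → c * c + (+ 2 * c * ∑Δ N s t + ∑Δ N s t * ∑Δ N s t))
      ≡⟨ sumSignPairs-shift m (c * c) _ ⟩
    + #signPairs m * (c * c) + sumSignPairs m (λ s t → + 2 * c * ∑Δ N s t + ∑Δ N s t * ∑Δ N s t)
      ≡⟨ cong (_+_ (+ #signPairs m * (c * c))) (sumSignPairs-distrib-+ m (λ s t → + 2 * c * ∑Δ N s t) _) ⟩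
    + #signPairs m * (c * c) + (sumSignPairs m (λ s t → + 2 * c * ∑Δ N s t) + sumSignPairs m (λ s t → ∑Δ N s t * ∑Δ N s t))
      ≡⟨ cong (λ x → + #signPairs m * (c * c) + (x + sumSignPairs m (λ s t → ∑Δ N s t * ∑Δ N s t)))
              (trans (sumSignPairs-*ˡ m (+ 2 * c) (∑Δ N)) (trans (cong (_*_ (+ 2 * c)) (sumSignPairs-∑Δ m)) (ℤₚ.*-zeroʳ (+ 2 * c)))) ⟩
    + #signPairs m * (c * c) + (0ℤ + sumSignPairs m (λ s t → ∑Δ N s t * ∑Δ N s t))
      ≡⟨ cong (_+_ (+ #signPairs m * (c * c))) (ℤₚ.+-identityˡ _) ⟩
    + #signPairs m * (c * c) + sumSignPairs m (λ s t → ∑Δ N s t * ∑Δ N s t) ∎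
    where
    open ≡-Reasoning
    square : ∀ D → (c + D) * (c + D) ≡ c * c + (+ 2 * c * D + D * D)
    square D = solve 2 (λ c D → (c :+ D) :* (c :+ D) := c :* c :+ (con (+ 2) :* c :* D :+ D :* D)) refl c D

  -- Increments in distinct coordinates are uncorrelated (sumSignPairs-∑Δ), so the cross terms of the
  -- square average out.
  sumSignPairs-[∑Δ]² : ∀ m → sumSignPairs m (λ s t → ∑Δ N s t * ∑Δ N s t) ≡ sumSignPairs m (∑Δ² N)
  sumSignPairs-[∑Δ]² ℕ.zero    = refl
  sumSignPairs-[∑Δ]² (ℕ.suc m) = begin
    sumSignPairs (ℕ.suc m) (λ s t → ∑Δ N s t * ∑Δ N s t)
      ≡⟨ sumSignPairs-suc m (λ s t → ∑Δ N s t * ∑Δ N s t) ⟩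
    ∑Bool² (λ b c → sumSignPairs m (λ s t → (δ b c + ∑Δ N s t) * (δ b c + ∑Δ N s t)))
      ≡⟨ ∑Bool²-cong (λ b c → trans (sumSignPairs-[c+∑Δ]² m (δ b c))
                                    (cong (_+_ (+ #signPairs m * (δ b c * δ b c))) (sumSignPairs-[∑Δ]² m))) ⟩
    ∑Bool² (λ b c → + #signPairs m * (δ b c * δ b c) + sumSignPairs m (∑Δ² N))
      ≡⟨ ∑Bool²-cong (λ b c → sumSignPairs-shift m (δ b c * δ b c) (∑Δ² N)) ⟨
    ∑Bool² (λ b c → sumSignPairs m (λ s t → δ b c * δ b c + ∑Δ² N s t))
      ≡⟨ sumSignPairs-suc m (∑Δ² N) ⟨
    sumSignPairs (ℕ.suc m) (∑Δ² N) ∎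
    where open ≡-Reasoning

module CyclotomicProperties (p : ℕ) .{{p≢0 : ℕ.NonZero p}} where
  open Cyclotomic p {{p≢0}} public
  open FiniteSums
  open import Data.Fin.Properties using (_≟_; toℕ-fromℕ<; toℕ-injective)
  open import Data.Integer using (_*_; 1ℤ; 0ℤ)
  open import Data.Nat.DivMod using (_%_; _mod_; m<n⇒m%n≡m)
  open import Relation.Nullary using (yes; no)
  open ℤ-Sum using (sum-syntax; sum-cong-≗; ∑-comm; *-distribˡ-sum; *-distribʳ-sum)

  ωpow-hit : ∀ j {m : Fin p} → toℕ m ≡ j % p → ωpow j m ≡ 1ℤ
  ωpow-hit j {m} m≡j with m ≟ (j mod p)
  ... | yes _   = refl
  ... | no  m≢j = ⊥-elim (m≢j (toℕ-injective (trans m≡j (sym (toℕ-fromℕ< _)))))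

  ωpow-miss : ∀ j {m : Fin p} → toℕ m ≢ j % p → ωpow j m ≡ 0ℤ
  ωpow-miss j {m} m≢j with m ≟ (j mod p)
  ... | yes m≡j = ⊥-elim (m≢j (trans (cong toℕ m≡j) (toℕ-fromℕ< _)))
  ... | no  _   = refl

  ∑-ωpow : ∀ j → ∑[ m < p ] ωpow j m ≡ 1ℤ
  ∑-ωpow j = trans (∑-pick (ωpow j) (j mod p) (λ m m≢j → ωpow-miss j (m≢j ∘ toℕ-injective ∘ flip trans (sym (toℕ-fromℕ< _)))))
                   (ωpow-hit j (toℕ-fromℕ< _))

  ⊗-coord : ∀ γ δ m → (γ ⊗ δ) m ≡ ∑[ i < p ] ∑[ j < p ] (γ i * δ j * ωpow (toℕ i ℕ.+ toℕ j) m)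
  ⊗-coord γ δ m = trans (sumFinℤ≡∑ p _) (sum-cong-≗ (λ i → sumFinℤ≡∑ p (λ j → γ i * δ j * ωpow (toℕ i ℕ.+ toℕ j) m)))

  ∑-⊗ : ∀ γ δ → ∑[ m < p ] (γ ⊗ δ) m ≡ (∑[ i < p ] γ i) * (∑[ j < p ] δ j)
  ∑-⊗ γ δ = begin
    ∑[ m < p ] (γ ⊗ δ) m
      ≡⟨ sum-cong-≗ (⊗-coord γ δ) ⟩
    ∑[ m < p ] ∑[ i < p ] ∑[ j < p ] (γ i * δ j * ωpow (toℕ i ℕ.+ toℕ j) m)
      ≡⟨ ∑-comm (λ m i → ∑[ j < p ] (γ i * δ j * ωpow (toℕ i ℕ.+ toℕ j) m)) ⟩
    ∑[ i < p ] ∑[ m < p ] ∑[ j < p ] (γ i * δ j * ωpow (toℕ i ℕ.+ toℕ j) m)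
      ≡⟨ sum-cong-≗ (λ i → ∑-comm (λ m j → γ i * δ j * ωpow (toℕ i ℕ.+ toℕ j) m)) ⟩
    ∑[ i < p ] ∑[ j < p ] ∑[ m < p ] (γ i * δ j * ωpow (toℕ i ℕ.+ toℕ j) m)
      ≡⟨ sum-cong-≗ (λ i → sum-cong-≗ (λ j → sym (*-distribˡ-sum (γ i * δ j) (ωpow (toℕ i ℕ.+ toℕ j))))) ⟩
    ∑[ i < p ] ∑[ j < p ] (γ i * δ j * ∑[ m < p ] ωpow (toℕ i ℕ.+ toℕ j) m)
      ≡⟨ sum-cong-≗ (λ i → sum-cong-≗ (λ j → trans (cong (_*_ (γ i * δ j)) (∑-ωpow _)) (ℤₚ.*-identityʳ _))) ⟩
    ∑[ i < p ] ∑[ j < p ] (γ i * δ j)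
      ≡⟨ sum-cong-≗ (λ i → sym (*-distribˡ-sum (γ i) δ)) ⟩
    ∑[ i < p ] (γ i * ∑[ j < p ] δ j)
      ≡⟨ sym (*-distribʳ-sum _ γ) ⟩
    (∑[ i < p ] γ i) * (∑[ j < p ] δ j) ∎
    where open ≡-Reasoning

  ⊗-ωpow : ∀ γ {J} → J ℕ.< p → ∀ m → (γ ⊗ ωpow J) m ≡ ∑[ i < p ] (γ i * ωpow (toℕ i ℕ.+ J) m)
  ⊗-ωpow γ {J} J<p m = trans (⊗-coord γ (ωpow J) m) (sum-cong-≗ pick-J)
    where
    J′ = Fin.fromℕ< J<p
    toℕJ′≡J%p : toℕ J′ ≡ J % p
    toℕJ′≡J%p = trans (toℕ-fromℕ< J<p) (sym (m<n⇒m%n≡m J<p))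
    pick-J : ∀ i → ∑[ j < p ] (γ i * ωpow J j * ωpow (toℕ i ℕ.+ toℕ j) m) ≡ γ i * ωpow (toℕ i ℕ.+ J) m
    pick-J i = begin
      ∑[ j < p ] (γ i * ωpow J j * ωpow (toℕ i ℕ.+ toℕ j) m)
        ≡⟨ ∑-pick _ J′ off-J′ ⟩
      γ i * ωpow J J′ * ωpow (toℕ i ℕ.+ toℕ J′) m
        ≡⟨ cong₂ (λ w j → γ i * w * ωpow (toℕ i ℕ.+ j) m) (ωpow-hit J toℕJ′≡J%p) (toℕ-fromℕ< J<p) ⟩
      γ i * 1ℤ * ωpow (toℕ i ℕ.+ J) m
        ≡⟨ cong (_* _) (ℤₚ.*-identityʳ (γ i)) ⟩
      γ i * ωpow (toℕ i ℕ.+ J) m ∎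
      where
      open ≡-Reasoning
      off-J′ : ∀ j → j ≢ J′ → γ i * ωpow J j * ωpow (toℕ i ℕ.+ toℕ j) m ≡ 0ℤ
      off-J′ j j≢J′ = trans (cong (λ w → γ i * w * _) (ωpow-miss J (j≢J′ ∘ toℕ-injective ∘ flip trans (sym toℕJ′≡J%p))))
                            (cong (_* _) (ℤₚ.*-zeroʳ (γ i)))

-- The NonZero instance is a parameter so that everything below carries the instance of the final
-- statement; with two different instances Agda would compare terms by unfolding Cyclotomic.A.
module PrimeCyclotomic (k : ℕ) .{{p≢0 : ℕ.NonZero (ℕ.2+ k)}} (p-prime : Prime (ℕ.2+ k)) where
  open CyclotomicProperties (ℕ.2+ k) {{p≢0}} public
  open FiniteSums
  open ResidueArithmetic
  open SignSums using (signed; Δ; ∑Δ; ∑Δ²)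
  open import Data.Fin.Properties using (toℕ<n; toℕ-fromℕ<; toℕ-injective; opposite-prop)
  open import Data.Integer using (ℤ; +_; _+_; _-_; _*_; 0ℤ; 1ℤ)
  open import Data.Integer.Solver using (module +-*-Solver)
  open +-*-Solver using (solve; _:=_; _:+_; _:-_; _:*_; con)
  open import Data.Nat.DivMod using (n%n≡0; m<n⇒m%n≡m)
  open import Data.Nat.Properties using (*-zeroʳ; suc-injective; 1+n≢0; 0≢1+n; m∸n+n≡m; +-cancelʳ-≡; ≤-trans; m≤n+m; +-mono-<)
  open ℤ-Sum using (sum-syntax; sum-cong-≗; ∑-comm; *-distribˡ-sum)

  p n : ℕ
  p = ℕ.2+ k
  n = ℕ.suc k

  TrElt-coord : ∀ γ m → TrElt γ m ≡ ∑[ c < n ] ∑[ i < p ] (γ i * ωpow (ℕ.suc (toℕ c) ℕ.* toℕ i) m)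
  TrElt-coord γ m = trans (sumFinℤ≡∑ n (λ c → σ (ℕ.suc (toℕ c)) γ m))
    (sum-cong-≗ {n} (λ c → sumFinℤ≡∑ p (λ i → γ i * ωpow (ℕ.suc (toℕ c) ℕ.* toℕ i) m)))

  TrElt-zero : ∀ γ → TrElt γ zero ≡ + n * γ zero
  TrElt-zero γ = begin
    TrElt γ zero
      ≡⟨ TrElt-coord γ zero ⟩
    ∑[ c < n ] ∑[ i < p ] (γ i * ωpow (ℕ.suc (toℕ c) ℕ.* toℕ i) zero)
      ≡⟨ sum-cong-≗ {n} (λ c → ∑-pick (λ i → γ i * ωpow (ℕ.suc (toℕ c) ℕ.* toℕ i) zero) zero (off-zero c)) ⟩
    ∑[ c < n ] (γ zero * ωpow (ℕ.suc (toℕ c) ℕ.* 0) zero)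
      ≡⟨ sum-cong-≗ {n} at-zero ⟩
    ∑[ c < n ] γ zero
      ≡⟨ ∑-const n (γ zero) ⟩
    + n * γ zero ∎
    where
    open ≡-Reasoning
    off-zero : ∀ (c : Fin n) i → i ≢ zero → γ i * ωpow (ℕ.suc (toℕ c) ℕ.* toℕ i) zero ≡ 0ℤ
    off-zero c zero    0≢0 = ⊥-elim (0≢0 refl)
    off-zero c (suc i) _   = trans (cong (_*_ (γ (suc i))) (ωpow-miss (ℕ.suc (toℕ c) ℕ.* toℕ (suc i))
      (*-%-≢0 p-prime ℕ.z<s (toℕ<n (suc i)) ℕ.z<s (toℕ<n (suc c)) ∘ sym))) (ℤₚ.*-zeroʳ (γ (suc i)))
    at-zero : ∀ c → γ zero * ωpow (ℕ.suc (toℕ c) ℕ.* 0) zero ≡ γ zero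
    at-zero c = trans (cong (_*_ (γ zero)) (ωpow-hit (ℕ.suc (toℕ c) ℕ.* 0) (cong (ℕ._% p) (sym (*-zeroʳ (ℕ.suc (toℕ c)))))))
                      (ℤₚ.*-identityʳ (γ zero))

  ∑-ωpow-multiples-of-0 : ∑[ c < n ] ωpow (ℕ.suc (toℕ c) ℕ.* 0) (suc zero) ≡ 0ℤ
  ∑-ωpow-multiples-of-0 = ∑-vanish {n} (λ c → ωpow (ℕ.suc (toℕ c) ℕ.* 0) (suc zero))
    (λ c → ωpow-miss (ℕ.suc (toℕ c) ℕ.* 0) (λ 1≡ → 1+n≢0 (trans 1≡ (cong (ℕ._% p) (*-zeroʳ (ℕ.suc (toℕ c)))))))

  ∑-ωpow-multiples-of-unit : ∀ {b} → 0 ℕ.< b → b ℕ.< p → ∑[ c < n ] ωpow (ℕ.suc (toℕ c) ℕ.* b) (suc zero) ≡ 1ℤ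
  ∑-ωpow-multiples-of-unit {b} 0<b b<p = pick-inverse (%-inverseˡ p-prime 0<b b<p)
    where
    pick-inverse : ∃[ a ] 0 ℕ.< a × a ℕ.< p × (a ℕ.* b) ℕ.% p ≡ 1 → ∑[ c < n ] ωpow (ℕ.suc (toℕ c) ℕ.* b) (suc zero) ≡ 1ℤ
    pick-inverse (ℕ.suc a , _ , ℕ.s≤s a<n , ab≡1) =
      trans (∑-pick (λ c → ωpow (ℕ.suc (toℕ c) ℕ.* b) (suc zero)) c₀ other) (ωpow-hit (ℕ.suc (toℕ c₀) ℕ.* b) (sym c₀b≡1))
      where
      c₀ = Fin.fromℕ< a<n
      c₀b≡1 : (ℕ.suc (toℕ c₀) ℕ.* b) ℕ.% p ≡ 1
      c₀b≡1 = trans (cong (λ x → (ℕ.suc x ℕ.* b) ℕ.% p) (toℕ-fromℕ< a<n)) ab≡1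
      other : ∀ c → c ≢ c₀ → ωpow (ℕ.suc (toℕ c) ℕ.* b) (suc zero) ≡ 0ℤ
      other c c≢c₀ = ωpow-miss (ℕ.suc (toℕ c) ℕ.* b) (λ 1≡cb → c≢c₀ (toℕ-injective (suc-injective
        (*-%-cancelʳ p-prime 0<b b<p (toℕ<n (suc c)) (toℕ<n (suc c₀)) (trans (sym 1≡cb) (sym c₀b≡1))))))

  TrElt-one : ∀ γ → TrElt γ (suc zero) ≡ ∑[ i < n ] γ (suc i)
  TrElt-one γ = begin
    TrElt γ (suc zero)
      ≡⟨ TrElt-coord γ (suc zero) ⟩
    ∑[ c < n ] ∑[ i < p ] (γ i * ωpow (ℕ.suc (toℕ c) ℕ.* toℕ i) (suc zero))
      ≡⟨ ∑-comm {n} {p} (λ c i → γ i * ωpow (ℕ.suc (toℕ c) ℕ.* toℕ i) (suc zero)) ⟩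
    ∑[ i < p ] ∑[ c < n ] (γ i * ωpow (ℕ.suc (toℕ c) ℕ.* toℕ i) (suc zero))
      ≡⟨ sum-cong-≗ {p} (λ i → sym (*-distribˡ-sum {n} (γ i) (λ c → ωpow (ℕ.suc (toℕ c) ℕ.* toℕ i) (suc zero)))) ⟩
    ∑[ i < p ] (γ i * ∑[ c < n ] ωpow (ℕ.suc (toℕ c) ℕ.* toℕ i) (suc zero))
      ≡⟨ cong₂ _+_ (cong (_*_ (γ zero)) ∑-ωpow-multiples-of-0)
                   (sum-cong-≗ {n} (λ i → cong (_*_ (γ (suc i))) (∑-ωpow-multiples-of-unit ℕ.z<s (toℕ<n (suc i))))) ⟩
    γ zero * 0ℤ + ∑[ i < n ] (γ (suc i) * 1ℤ)
      ≡⟨ cong₂ _+_ (ℤₚ.*-zeroʳ (γ zero)) (sum-cong-≗ {n} (λ i → ℤₚ.*-identityʳ (γ (suc i)))) ⟩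
    0ℤ + ∑[ i < n ] γ (suc i)
      ≡⟨ ℤₚ.+-identityˡ _ ⟩
    ∑[ i < n ] γ (suc i) ∎
    where open ≡-Reasoning

  Tr-formula : ∀ γ → Tr γ ≡ + p * γ zero - ∑[ i < p ] γ i
  Tr-formula γ = begin
    Tr γ
      ≡⟨ cong₂ _-_ (TrElt-zero γ) (TrElt-one γ) ⟩
    + n * γ zero - ∑[ i < n ] γ (suc i)
      ≡⟨ solve 3 (λ n g s → n :* g :- s := (con 1ℤ :+ n) :* g :- (g :+ s)) refl (+ n) (γ zero) (∑[ i < n ] γ (suc i)) ⟩
    + p * γ zero - ∑[ i < p ] γ i ∎
    where open ≡-Reasoning

  ⊗-ωpow-zero : ∀ γ (j : Fin n) → (γ ⊗ ωpow (ℕ.suc (toℕ j))) zero ≡ γ (suc (opposite j))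
  ⊗-ωpow-zero γ j = begin
    (γ ⊗ ωpow J) zero                         ≡⟨ ⊗-ωpow γ J<p zero ⟩
    ∑[ i < p ] (γ i * ωpow (toℕ i ℕ.+ J) zero) ≡⟨ ∑-pick (λ i → γ i * ωpow (toℕ i ℕ.+ J) zero) i₀ off-i₀ ⟩
    γ i₀ * ωpow (toℕ i₀ ℕ.+ J) zero            ≡⟨ cong (_*_ (γ i₀)) (ωpow-hit (toℕ i₀ ℕ.+ J) i₀+J≡0) ⟩
    γ i₀ * 1ℤ                                  ≡⟨ ℤₚ.*-identityʳ (γ i₀) ⟩
    γ i₀                                       ∎
    where
    open ≡-Reasoning
    J = ℕ.suc (toℕ j)
    J<p = ℕ.s≤s (toℕ<n j)
    i₀ = suc (opposite j)
    i₀+J≡p : toℕ i₀ ℕ.+ J ≡ p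
    i₀+J≡p = cong ℕ.suc (trans (cong (ℕ._+ J) (opposite-prop j)) (m∸n+n≡m (toℕ<n j)))
    i₀+J≡0 : 0 ≡ (toℕ i₀ ℕ.+ J) ℕ.% p
    i₀+J≡0 = sym (trans (cong (ℕ._% p) i₀+J≡p) (n%n≡0 p))
    i+J≡0⇒i≡i₀ : ∀ i → (toℕ i ℕ.+ J) ℕ.% p ≡ 0 → i ≡ i₀
    i+J≡0⇒i≡i₀ i i+J≡0 = toℕ-injective (+-cancelʳ-≡ J (toℕ i) (toℕ i₀)
      (trans (m%n≡0⇒m≡n (≤-trans (ℕ.s≤s ℕ.z≤n) (m≤n+m J (toℕ i))) (+-mono-< (toℕ<n i) J<p) i+J≡0) (sym i₀+J≡p)))
    off-i₀ : ∀ i → i ≢ i₀ → γ i * ωpow (toℕ i ℕ.+ J) zero ≡ 0ℤ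
    off-i₀ i i≢i₀ = trans (cong (_*_ (γ i)) (ωpow-miss (toℕ i ℕ.+ J) (i≢i₀ ∘ i+J≡0⇒i≡i₀ i ∘ sym))) (ℤₚ.*-zeroʳ (γ i))

  Tr-⊗-ωpow : ∀ γ (j : Fin n) → Tr (γ ⊗ ωpow (ℕ.suc (toℕ j))) ≡ + p * γ (suc (opposite j)) - ∑[ i < p ] γ i
  Tr-⊗-ωpow γ j = begin
    Tr (γ ⊗ ωpow J)
      ≡⟨ Tr-formula (γ ⊗ ωpow J) ⟩
    + p * (γ ⊗ ωpow J) zero - ∑[ m < p ] (γ ⊗ ωpow J) m
      ≡⟨ cong₂ (λ a b → + p * a - b) (⊗-ωpow-zero γ j) (∑-⊗ γ (ωpow J)) ⟩
    + p * γ (suc (opposite j)) - (∑[ i < p ] γ i) * (∑[ m < p ] ωpow J m)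
      ≡⟨ cong (λ b → + p * γ (suc (opposite j)) - (∑[ i < p ] γ i) * b) (∑-ωpow J) ⟩
    + p * γ (suc (opposite j)) - (∑[ i < p ] γ i) * 1ℤ
      ≡⟨ cong (λ b → + p * γ (suc (opposite j)) - b) (ℤₚ.*-identityʳ _) ⟩
    + p * γ (suc (opposite j)) - ∑[ i < p ] γ i ∎
    where
    open ≡-Reasoning
    J = ℕ.suc (toℕ j)

  normSq-formula : ∀ γ → normSq γ ≡ ∑[ j < n ] ((+ p * γ (suc j) - ∑[ i < p ] γ i) * (+ p * γ (suc j) - ∑[ i < p ] γ i))
  normSq-formula γ = begin
    normSq γ
      ≡⟨ sumFinℤ≡∑ n (λ j → Tr (γ ⊗ ωpow (ℕ.suc (toℕ j))) * Tr (γ ⊗ ωpow (ℕ.suc (toℕ j)))) ⟩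
    ∑[ j < n ] (Tr (γ ⊗ ωpow (ℕ.suc (toℕ j))) * Tr (γ ⊗ ωpow (ℕ.suc (toℕ j))))
      ≡⟨ sum-cong-≗ {n} (λ j → cong₂ _*_ (Tr-⊗-ωpow γ j) (Tr-⊗-ωpow γ j)) ⟩
    ∑[ j < n ] f (opposite j)
      ≡⟨ ∑-reverse f ⟩
    ∑[ j < n ] f j ∎
    where
    open ≡-Reasoning
    f : Fin n → ℤ
    f j = (+ p * γ (suc j) - ∑[ i < p ] γ i) * (+ p * γ (suc j) - ∑[ i < p ] γ i)

  vElt-coord : ∀ N s m → vElt N s m ≡ ∑[ j < n ] (signed N (s j) * ωpow (ℕ.suc (toℕ j)) m)
  vElt-coord N s m = sumFinℤ≡∑ n (λ j → signed N (s j) * ωpow (ℕ.suc (toℕ j)) m)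

  vElt-zero : ∀ N s → vElt N s zero ≡ 0ℤ
  vElt-zero N s = trans (vElt-coord N s zero) (∑-vanish {n} (λ j → signed N (s j) * ωpow (ℕ.suc (toℕ j)) zero) (λ j →
    trans (cong (_*_ (signed N (s j))) (ωpow-miss (ℕ.suc (toℕ j)) (λ 0≡ → 0≢1+n (trans 0≡ (m<n⇒m%n≡m (toℕ<n (suc j)))))))
          (ℤₚ.*-zeroʳ (signed N (s j)))))

  vElt-suc : ∀ N s i → vElt N s (suc i) ≡ signed N (s i)
  vElt-suc N s i = begin
    vElt N s (suc i)
      ≡⟨ vElt-coord N s (suc i) ⟩
    ∑[ j < n ] (signed N (s j) * ωpow (ℕ.suc (toℕ j)) (suc i))
      ≡⟨ ∑-pick (λ j → signed N (s j) * ωpow (ℕ.suc (toℕ j)) (suc i)) i off-i ⟩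
    signed N (s i) * ωpow (ℕ.suc (toℕ i)) (suc i)
      ≡⟨ cong (_*_ (signed N (s i))) (ωpow-hit (ℕ.suc (toℕ i)) (sym (m<n⇒m%n≡m (toℕ<n (suc i))))) ⟩
    signed N (s i) * 1ℤ
      ≡⟨ ℤₚ.*-identityʳ (signed N (s i)) ⟩
    signed N (s i) ∎
    where
    open ≡-Reasoning
    off-i : ∀ j → j ≢ i → signed N (s j) * ωpow (ℕ.suc (toℕ j)) (suc i) ≡ 0ℤ
    off-i j j≢i = trans (cong (_*_ (signed N (s j))) (ωpow-miss (ℕ.suc (toℕ j))
      (λ i≡j → j≢i (toℕ-injective (suc-injective (sym (trans i≡j (m<n⇒m%n≡m (toℕ<n (suc j))))))))))
      (ℤₚ.*-zeroʳ (signed N (s j)))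

  dist² : ℕ → (Fin n → Bool) → (Fin n → Bool) → ℤ
  dist² N s t = normSq (vElt N t ⊖ vElt N s)

  dist²-formula : ∀ N s t → dist² N s t ≡ + p * + p * ∑Δ² N s t - (+ p + 1ℤ) * (∑Δ N s t * ∑Δ N s t)
  dist²-formula N s t = begin
    normSq γ
      ≡⟨ normSq-formula γ ⟩
    ∑[ j < n ] ((+ p * γ (suc j) - ∑[ i < p ] γ i) * (+ p * γ (suc j) - ∑[ i < p ] γ i))
      ≡⟨ sum-cong-≗ {n} (λ j → cong₂ (λ a b → (+ p * a - b) * (+ p * a - b)) (γ-suc j) ∑γ) ⟩
    ∑[ j < n ] ((+ p * Δ N s t j - ∑Δ N s t) * (+ p * Δ N s t j - ∑Δ N s t))
      ≡⟨ ∑-scaled-deviation² (+ p) (Δ N s t) ⟩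
    + p * + p * ∑Δ² N s t - (+ 2 * + p - + n) * (∑Δ N s t * ∑Δ N s t)
      ≡⟨ cong (λ c → + p * + p * ∑Δ² N s t - c * (∑Δ N s t * ∑Δ N s t))
              (solve 1 (λ n → con (+ 2) :* (con 1ℤ :+ n) :- n := (con 1ℤ :+ n) :+ con 1ℤ) refl (+ n)) ⟩
    + p * + p * ∑Δ² N s t - (+ p + 1ℤ) * (∑Δ N s t * ∑Δ N s t) ∎
    where
    open ≡-Reasoning
    γ = vElt N t ⊖ vElt N s
    γ-suc : ∀ j → γ (suc j) ≡ Δ N s t j
    γ-suc j = cong₂ _-_ (vElt-suc N t j) (vElt-suc N s j)
    ∑γ : ∑[ i < p ] γ i ≡ ∑Δ N s t
    ∑γ = trans (cong₂ _+_ (cong₂ _-_ (vElt-zero N t) (vElt-zero N s)) (sum-cong-≗ {n} γ-suc)) (ℤₚ.+-identityˡ _)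

module Fractions where
  open SignSums using (sumSignsℤ; sumSignPairs)
  open import Data.Integer using (ℤ; +_; _+_; _-_; _*_; 1ℤ)
  open import Data.Integer.Solver using (module +-*-Solver)
  open +-*-Solver using (solve; _:=_; _:-_; _:*_; con)
  import Data.Nat.Properties as ℕₚ
  open import Data.Rational as ℚ using (ℚ; _/_; toℚᵘ)
  import Data.Rational.Properties as ℚₚ
  open import Data.Rational.Unnormalised as ℚᵘ using (mkℚᵘ; *≡*)
  import Data.Rational.Unnormalised.Properties as ℚᵘₚ

  toℚᵘ-/ : ∀ x d → toℚᵘ (x / ℕ.suc d) ℚᵘ.≃ mkℚᵘ x d
  toℚᵘ-/ x d = ℚₚ.toℚᵘ-fromℚᵘ (mkℚᵘ x d)

  private instance
    *-nonZero : ∀ {d e} .{{_ : ℕ.NonZero d}} .{{_ : ℕ.NonZero e}} → ℕ.NonZero (d ℕ.* e)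
    *-nonZero {d} {e} = ℕₚ.m*n≢0 d e

  /-+-/ : ∀ x y d e .{{_ : ℕ.NonZero d}} .{{_ : ℕ.NonZero e}} → (x / d) ℚ.+ (y / e) ≡ (x * + e + y * + d) / (d ℕ.* e)
  /-+-/ x y (ℕ.suc d) (ℕ.suc e) = ℚₚ.toℚᵘ-injective (begin
    toℚᵘ ((x / ℕ.suc d) ℚ.+ (y / ℕ.suc e))          ≈⟨ ℚₚ.toℚᵘ-homo-+ (x / ℕ.suc d) (y / ℕ.suc e) ⟩
    toℚᵘ (x / ℕ.suc d) ℚᵘ.+ toℚᵘ (y / ℕ.suc e)      ≈⟨ ℚᵘₚ.+-cong (toℚᵘ-/ x d) (toℚᵘ-/ y e) ⟩
    mkℚᵘ x d ℚᵘ.+ mkℚᵘ y e                          ≈⟨ toℚᵘ-/ _ _ ⟨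
    toℚᵘ ((x * + ℕ.suc e + y * + ℕ.suc d) / (ℕ.suc d ℕ.* ℕ.suc e)) ∎)
    where open ℚᵘₚ.≃-Reasoning

  /-*-/ : ∀ x y d e .{{_ : ℕ.NonZero d}} .{{_ : ℕ.NonZero e}} → (x / d) ℚ.* (y / e) ≡ (x * y) / (d ℕ.* e)
  /-*-/ x y (ℕ.suc d) (ℕ.suc e) = ℚₚ.toℚᵘ-injective (begin
    toℚᵘ ((x / ℕ.suc d) ℚ.* (y / ℕ.suc e))          ≈⟨ ℚₚ.toℚᵘ-homo-* (x / ℕ.suc d) (y / ℕ.suc e) ⟩
    toℚᵘ (x / ℕ.suc d) ℚᵘ.* toℚᵘ (y / ℕ.suc e)      ≈⟨ ℚᵘₚ.*-cong (toℚᵘ-/ x d) (toℚᵘ-/ y e) ⟩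
    mkℚᵘ x d ℚᵘ.* mkℚᵘ y e                          ≈⟨ toℚᵘ-/ _ _ ⟨
    toℚᵘ ((x * y) / (ℕ.suc d ℕ.* ℕ.suc e))          ∎)
    where open ℚᵘₚ.≃-Reasoning

  /---/ : ∀ x y d e .{{_ : ℕ.NonZero d}} .{{_ : ℕ.NonZero e}} → (x / d) ℚ.- (y / e) ≡ (x * + e - y * + d) / (d ℕ.* e)
  /---/ x y (ℕ.suc d) (ℕ.suc e) = ℚₚ.toℚᵘ-injective (begin
    toℚᵘ ((x / ℕ.suc d) ℚ.- (y / ℕ.suc e))          ≈⟨ ℚₚ.toℚᵘ-homo-+ (x / ℕ.suc d) (ℚ.- (y / ℕ.suc e)) ⟩
    toℚᵘ (x / ℕ.suc d) ℚᵘ.+ toℚᵘ (ℚ.- (y / ℕ.suc e))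
      ≈⟨ ℚᵘₚ.+-cong (toℚᵘ-/ x d) (ℚᵘₚ.≃-trans (ℚₚ.toℚᵘ-homo‿- (y / ℕ.suc e)) (ℚᵘₚ.-‿cong (toℚᵘ-/ y e))) ⟩
    mkℚᵘ x d ℚᵘ.- mkℚᵘ y e
      ≈⟨ ℚᵘₚ.≃-reflexive (cong (λ z → mkℚᵘ (x * + ℕ.suc e + z) _) (sym (ℤₚ.neg-distribˡ-* y (+ ℕ.suc d)))) ⟩
    mkℚᵘ (x * + ℕ.suc e - y * + ℕ.suc d) _          ≈⟨ toℚᵘ-/ _ _ ⟨
    toℚᵘ ((x * + ℕ.suc e - y * + ℕ.suc d) / (ℕ.suc d ℕ.* ℕ.suc e)) ∎)
    where open ℚᵘₚ.≃-Reasoning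

  /-≡-/ : ∀ x y d e .{{_ : ℕ.NonZero d}} .{{_ : ℕ.NonZero e}} → x * + e ≡ y * + d → x / d ≡ y / e
  /-≡-/ x y (ℕ.suc d) (ℕ.suc e) cross = ℚₚ.fromℚᵘ-cong {mkℚᵘ x d} {mkℚᵘ y e} (*≡* cross)

  sumSigns-cong : ∀ m {f g : (Fin m → Bool) → ℚ} → (∀ s → f s ≡ g s) → sumSigns m f ≡ sumSigns m g
  sumSigns-cong ℕ.zero    f≗g = f≗g _
  sumSigns-cong (ℕ.suc m) f≗g = cong₂ ℚ._+_ (sumSigns-cong m (f≗g ∘ consB true)) (sumSigns-cong m (f≗g ∘ consB false))

  /1-+ : ∀ x y → (x / 1) ℚ.+ (y / 1) ≡ (x + y) / 1
  /1-+ x y = trans (/-+-/ x y 1 1) (ℚₚ./-cong (cong₂ _+_ (ℤₚ.*-identityʳ x) (ℤₚ.*-identityʳ y)) refl)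

  sumSigns-/1 : ∀ m (f : (Fin m → Bool) → ℤ) c → sumSigns m (λ s → (f s / 1) ℚ.* c) ≡ (sumSignsℤ m f / 1) ℚ.* c
  sumSigns-/1 ℕ.zero    f c = refl
  sumSigns-/1 (ℕ.suc m) f c = begin
    sumSigns m (λ s → (f (consB true s) / 1) ℚ.* c) ℚ.+ sumSigns m (λ s → (f (consB false s) / 1) ℚ.* c)
      ≡⟨ cong₂ ℚ._+_ (sumSigns-/1 m (f ∘ consB true) c) (sumSigns-/1 m (f ∘ consB false) c) ⟩
    (sumSignsℤ m (f ∘ consB true) / 1) ℚ.* c ℚ.+ (sumSignsℤ m (f ∘ consB false) / 1) ℚ.* c
      ≡⟨ ℚₚ.*-distribʳ-+ c (sumSignsℤ m (f ∘ consB true) / 1) (sumSignsℤ m (f ∘ consB false) / 1) ⟨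
    ((sumSignsℤ m (f ∘ consB true) / 1) ℚ.+ (sumSignsℤ m (f ∘ consB false) / 1)) ℚ.* c
      ≡⟨ cong (ℚ._* c) (/1-+ (sumSignsℤ m (f ∘ consB true)) (sumSignsℤ m (f ∘ consB false))) ⟩
    (sumSignsℤ (ℕ.suc m) f / 1) ℚ.* c ∎
    where open ≡-Reasoning

  sumSignPairs-/1 : ∀ m (F : (Fin m → Bool) → (Fin m → Bool) → ℤ) c →
    sumSigns m (λ s → sumSigns m (λ t → (F s t / 1) ℚ.* c)) ≡ (sumSignPairs m F / 1) ℚ.* c
  sumSignPairs-/1 m F c = trans (sumSigns-cong m (λ s → sumSigns-/1 m (F s) c)) (sumSigns-/1 m (λ s → sumSignsℤ m (F s)) c)

  invℕ-*-/1-*-invℕ : ∀ x m k .{{_ : ℕ.NonZero m}} .{{_ : ℕ.NonZero k}} → invℕ m ℚ.* ((x / 1) ℚ.* invℕ k) ≡ x / (m ℕ.* k)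
  invℕ-*-/1-*-invℕ x m@(ℕ.suc _) k@(ℕ.suc _) = begin
    (+ 1 / m) ℚ.* ((x / 1) ℚ.* (+ 1 / k)) ≡⟨ cong ((+ 1 / m) ℚ.*_) (/-*-/ x (+ 1) 1 k) ⟩
    (+ 1 / m) ℚ.* ((x * + 1) / (1 ℕ.* k)) ≡⟨ /-*-/ (+ 1) (x * + 1) m (1 ℕ.* k) ⟩
    (+ 1 * (x * + 1)) / (m ℕ.* (1 ℕ.* k)) ≡⟨ ℚₚ./-cong (trans (ℤₚ.*-identityˡ _) (ℤₚ.*-identityʳ x))
                                                      (cong (m ℕ.*_) (ℕₚ.*-identityˡ k)) ⟩
    x / (m ℕ.* k)                         ∎
    where open ≡-Reasoning

  half-[1-1/p-1/p²] : ∀ p′ → let p = ℕ.suc p′ in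
    (+ 1 / 2) ℚ.* (((+ 1 / 1) ℚ.- invℕ p) ℚ.- invℕ (p ℕ.* p)) ≡ (+ p * + p - + p - 1ℤ) / (2 ℕ.* (p ℕ.* p))
  half-[1-1/p-1/p²] p′ = begin
    (+ 1 / 2) ℚ.* (((+ 1 / 1) ℚ.- (+ 1 / p)) ℚ.- (+ 1 / (p ℕ.* p)))
      ≡⟨ cong (λ q → (+ 1 / 2) ℚ.* (q ℚ.- (+ 1 / (p ℕ.* p)))) (/---/ (+ 1) (+ 1) 1 p) ⟩
    (+ 1 / 2) ℚ.* ((a / (1 ℕ.* p)) ℚ.- (+ 1 / (p ℕ.* p)))
      ≡⟨ cong ((+ 1 / 2) ℚ.*_) (/---/ a (+ 1) (1 ℕ.* p) (p ℕ.* p)) ⟩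
    (+ 1 / 2) ℚ.* (b / (1 ℕ.* p ℕ.* (p ℕ.* p)))
      ≡⟨ /-*-/ (+ 1) b 2 (1 ℕ.* p ℕ.* (p ℕ.* p)) ⟩
    (+ 1 * b) / (2 ℕ.* (1 ℕ.* p ℕ.* (p ℕ.* p)))
      ≡⟨ /-≡-/ (+ 1 * b) (+ p * + p - + p - 1ℤ) (2 ℕ.* (1 ℕ.* p ℕ.* (p ℕ.* p))) (2 ℕ.* (p ℕ.* p)) cross ⟩
    (+ p * + p - + p - 1ℤ) / (2 ℕ.* (p ℕ.* p)) ∎
    where
    open ≡-Reasoning
    p = ℕ.suc p′
    a = + 1 * + p - + 1 * + 1
    b = a * + (p ℕ.* p) - + 1 * + (1 ℕ.* p)
    -- All factors are successors, so + (u ℕ.* v) and + u * + v agree definitionally.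
    cross : + 1 * b * + (2 ℕ.* (p ℕ.* p)) ≡ (+ p * + p - + p - 1ℤ) * + (2 ℕ.* (1 ℕ.* p ℕ.* (p ℕ.* p)))
    cross = solve 1 (λ p → con (+ 1) :* ((con (+ 1) :* p :- con (+ 1) :* con (+ 1)) :* (p :* p) :- con (+ 1) :* (con (+ 1) :* p))
                               :* (con (+ 2) :* (p :* p))
                         := (p :* p :- p :- con 1ℤ) :* (con (+ 2) :* (con (+ 1) :* p :* (p :* p))))
                    refl (+ p)

  average-fraction : ∀ x M K p′ .{{_ : ℕ.NonZero M}} .{{_ : ℕ.NonZero K}} → let p = ℕ.suc p′ in
    x * (+ 2 * (+ p * + p)) ≡ (+ p * + p - + p - 1ℤ) * (+ M * + K) →
    invℕ M ℚ.* ((x / 1) ℚ.* invℕ K) ≡ (+ 1 / 2) ℚ.* (((+ 1 / 1) ℚ.- invℕ p) ℚ.- invℕ (p ℕ.* p))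
  average-fraction x M@(ℕ.suc _) K@(ℕ.suc _) p′ cross = begin
    invℕ M ℚ.* ((x / 1) ℚ.* invℕ K)          ≡⟨ invℕ-*-/1-*-invℕ x M K ⟩
    x / (M ℕ.* K)                            ≡⟨ /-≡-/ x (+ p * + p - + p - 1ℤ) (M ℕ.* K) (2 ℕ.* (p ℕ.* p)) cross ⟩
    (+ p * + p - + p - 1ℤ) / (2 ℕ.* (p ℕ.* p)) ≡⟨ half-[1-1/p-1/p²] p′ ⟨
    (+ 1 / 2) ℚ.* (((+ 1 / 1) ℚ.- invℕ p) ℚ.- invℕ (p ℕ.* p)) ∎
    where
    open ≡-Reasoning
    p = ℕ.suc p′

module Average (k N : ℕ) .{{p≢0 : ℕ.NonZero (ℕ.2+ k)}} (p-prime : Prime (ℕ.2+ k)) where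
  open PrimeCyclotomic k {{p≢0}} p-prime
  open SignSums
  open SignMoments N
  open Fractions using (sumSignPairs-/1)
  open import Data.Integer using (ℤ; +_; _+_; _-_; _*_; 1ℤ)
  open import Data.Integer.Solver using (module +-*-Solver)
  open +-*-Solver using (solve; _:=_; _:+_; _:-_; _:*_; con)
  open import Data.Rational as ℚ using (_/_)

  M K : ℕ
  M = #signPairs n
  K = 4 ℕ.* N ℕ.* N ℕ.* p ℕ.* p ℕ.* n

  M≢0 : ℕ.NonZero M
  M≢0 = #signPairs≢0 n

  total V : ℤ
  total = sumSignPairs n (dist² N)
  V = + n * (+ M * (+ 2 * (+ N * + N)))

  A-as-fraction : A N ≡ invℕ M ℚ.* ((total / 1) ℚ.* invℕ K)
  A-as-fraction = cong (invℕ M ℚ.*_) (sumSignPairs-/1 n (dist² N) (invℕ K))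

  total-closed-form : total ≡ (+ p * + p - (+ p + 1ℤ)) * V
  total-closed-form = begin
    total
      ≡⟨ sumSignPairs-cong n (dist²-formula N) ⟩
    sumSignPairs n (λ s t → + p * + p * ∑Δ² N s t - (+ p + 1ℤ) * (∑Δ N s t * ∑Δ N s t))
      ≡⟨ sumSignPairs-distrib-- n (λ s t → + p * + p * ∑Δ² N s t) (λ s t → (+ p + 1ℤ) * (∑Δ N s t * ∑Δ N s t)) ⟩
    sumSignPairs n (λ s t → + p * + p * ∑Δ² N s t) - sumSignPairs n (λ s t → (+ p + 1ℤ) * (∑Δ N s t * ∑Δ N s t))
      ≡⟨ cong₂ _-_ (sumSignPairs-*ˡ n (+ p * + p) (∑Δ² N)) (sumSignPairs-*ˡ n (+ p + 1ℤ) (λ s t → ∑Δ N s t * ∑Δ N s t)) ⟩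
    + p * + p * sumSignPairs n (∑Δ² N) - (+ p + 1ℤ) * sumSignPairs n (λ s t → ∑Δ N s t * ∑Δ N s t)
      ≡⟨ cong (λ x → + p * + p * sumSignPairs n (∑Δ² N) - (+ p + 1ℤ) * x) (sumSignPairs-[∑Δ]² n) ⟩
    + p * + p * sumSignPairs n (∑Δ² N) - (+ p + 1ℤ) * sumSignPairs n (∑Δ² N)
      ≡⟨ cong (λ x → + p * + p * x - (+ p + 1ℤ) * x) (sumSignPairs-∑Δ² n) ⟩
    + p * + p * V - (+ p + 1ℤ) * V
      ≡⟨ solve 3 (λ a b v → a :* v :- b :* v := (a :- b) :* v) refl (+ p * + p) (+ p + 1ℤ) V ⟩
    (+ p * + p - (+ p + 1ℤ)) * V ∎
    where open ≡-Reasoning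

  +K≡ : + K ≡ + 4 * + N * + N * + p * + p * + n
  +K≡ = begin
    + K                                     ≡⟨ ℤₚ.pos-* (4 ℕ.* N ℕ.* N ℕ.* p ℕ.* p) n ⟩
    + (4 ℕ.* N ℕ.* N ℕ.* p ℕ.* p) * + n     ≡⟨ cong (_* + n) (ℤₚ.pos-* (4 ℕ.* N ℕ.* N ℕ.* p) p) ⟩
    + (4 ℕ.* N ℕ.* N ℕ.* p) * + p * + n     ≡⟨ cong (λ x → x * + p * + n) (ℤₚ.pos-* (4 ℕ.* N ℕ.* N) p) ⟩
    + (4 ℕ.* N ℕ.* N) * + p * + p * + n     ≡⟨ cong (λ x → x * + p * + p * + n) (ℤₚ.pos-* (4 ℕ.* N) N) ⟩
    + (4 ℕ.* N) * + N * + p * + p * + n     ≡⟨ cong (λ x → x * + N * + p * + p * + n) (ℤₚ.pos-* 4 N) ⟩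
    + 4 * + N * + N * + p * + p * + n       ∎
    where open ≡-Reasoning

  total-cross : total * (+ 2 * (+ p * + p)) ≡ (+ p * + p - + p - 1ℤ) * (+ M * + K)
  total-cross = begin
    total * (+ 2 * (+ p * + p))
      ≡⟨ cong (_* (+ 2 * (+ p * + p))) total-closed-form ⟩
    (+ p * + p - (+ p + 1ℤ)) * V * (+ 2 * (+ p * + p))
      ≡⟨ solve 3 (λ n N M → let p = con 1ℤ :+ n in
                   (p :* p :- (p :+ con 1ℤ)) :* (n :* (M :* (con (+ 2) :* (N :* N)))) :* (con (+ 2) :* (p :* p))
                := (p :* p :- p :- con 1ℤ) :* (M :* (con (+ 4) :* N :* N :* p :* p :* n)))
             refl (+ n) (+ N) (+ M) ⟩
    (+ p * + p - + p - 1ℤ) * (+ M * (+ 4 * + N * + N * + p * + p * + n))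
      ≡⟨ cong (λ x → (+ p * + p - + p - 1ℤ) * (+ M * x)) +K≡ ⟨
    (+ p * + p - + p - 1ℤ) * (+ M * + K) ∎
    where open ≡-Reasoning

open import Data.Nat using (NonZero; _≤_; _*_)
open import Data.Nat.Divisibility using (_∣_)
open import Data.Nat.Primality using (¬prime[0]; ¬prime[1])
open import Data.Integer using (+_)
open import Data.Rational using (_/_; _-_) renaming (_*_ to _*ℚ_)
open import Relation.Nullary using (¬_)
open Fractions using (average-fraction)

lemma5 : (p N : ℕ) .{{_ : NonZero p}} → Prime p → ¬ (2 ∣ p) → 1 ≤ N →
    Cyclotomic.A p N ≡ (+ 1 / 2) *ℚ (((+ 1 / 1) - invℕ p) - invℕ (p * p))
lemma5 0              _ p-prime _ _ = ⊥-elim (¬prime[0] p-prime)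
lemma5 1              _ p-prime _ _ = ⊥-elim (¬prime[1] p-prime)
lemma5 (ℕ.2+ k) (ℕ.suc N) {{p≢0}} p-prime _ _ =
  trans A-as-fraction (average-fraction total M K (ℕ.suc k) {{M≢0}} total-cross)
  where open Average k (ℕ.suc N) {{p≢0}} p-prime
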